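{- Define $b(1)=1$ and $b(n)=n+\sum_m b(m)$ for $n>1$, the sum over all proper divisors $m$ of $n$ (positive divisors $m<n$), and let $B(n)=b(n)/n$. Let $p$ and $q$ be distinct primes and $c,d$ nonnegative integers. Then $$B(p^c)=\frac{p-1-(2/p)^c}{p-2}\quad\text{for } p \text{ odd},\qquad B(2^c)=\frac{c+2}{2},$$ $$B(p^cq^d)=\frac12+\frac12\sum_{i=0}^{c}\frac{2^i}{p^i}\sum_{j=0}^{d}\frac{1}{q^j}\sum_{k=0}^{j}\binom{i+k}{k}\binom{j}{k},$$ and, if $q\neq 2$, $$B(2^cq^d)=\frac12+\frac12\sum_{j=0}^{d}\frac{1}{q^j}\sum_{k=0}^{j}\binom{j}{k}\binom{c+k+1}{k+1}.$$
   Context: $b(n)$ is called the sum of recursive divisors of $n$. -}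

module Defs where

open import Data.Nat using (ℕ; zero; suc; _+_; _*_; _∸_; _^_; _<_)
open import Data.Nat.Divisibility using (_∣?_)
open import Data.Nat.Induction using (<-rec)
open import Data.Fin using (Fin; toℕ)
open import Data.Fin.Properties using (toℕ<n)
open import Data.Integer using (ℤ; +_)
open import Data.Rational using (ℚ; _/_; 0ℚ) renaming (_+_ to _+ℚ_; _*_ to _*ℚ_)
open import Relation.Nullary using (yes; no)

sumFin : (n : ℕ) → (Fin n → ℕ) → ℕ
sumFin zero    f = 0
sumFin (suc n) f = f Fin.zero + sumFin n (λ i → f (Fin.suc i))

-- For n ≥ 1 the candidates m = toℕ i range over 0 … n-1; m = 0 never
-- divides n ≥ 1, so exactly the proper divisors are summed.
-- In particular b 1 = 1.  (b 0 = 0 is an irrelevant junk value.)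
b : ℕ → ℕ
b = <-rec (λ _ → ℕ) step
  where
  step : (n : ℕ) → (∀ {m} → m < n → ℕ) → ℕ
  step n rec = n + sumFin n (λ i → term i)
    where
    term : Fin n → ℕ
    term i with toℕ i ∣? n
    ... | yes _ = rec (toℕ<n i)
    ... | no  _ = 0

ℕ→ℚ : ℕ → ℚ
ℕ→ℚ n = (+ n) / 1

-- division of a rational by a natural number (junk value 0 for d = 0)
_/ℕ_ : ℚ → ℕ → ℚ
x /ℕ zero  = 0ℚ
x /ℕ suc d = x *ℚ ((+ 1) / suc d)

B : ℕ → ℚ
B n = ℕ→ℚ (b n) /ℕ n

sumTo : ℕ → (ℕ → ℚ) → ℚ
sumTo zero    f = f 0
sumTo (suc n) f = sumTo n f +ℚ f (suc n)

-- Write f(c, d) = b(pᶜ qᵈ) and N(c, d) = pᶜ qᵈ. The divisors of N(c, d) are exactly the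
-- N(i, j) with i ≤ c and j ≤ d, so the definition of b reads 2 f = N + Σ f, where Σ is the
-- double partial sum. The mixed difference Δ = (1 - X)(1 - Y), X and Y the shifts in c and
-- d, inverts Σ and turns this into the triangular recurrence (1 - 2X - 2Y + 2XY) f = Δ N,
-- which has a unique solution. Multiplying by the geometric weight N replaces X, Y by X/p,
-- Y/q, so N (1 + Σ u) / 2 is that solution as soon as (1 - 2X/p - 2Y/q + 2XY/pq) u is the
-- unit impulse at the origin. For u(i, j) = (2/p)ⁱ q⁻ʲ A(i, j) with
-- A(i, j) = Σₖ C(i+k, k) C(j, k) this amounts to A(i+1, j+1) = A(i, j+1) + 2 A(i+1, j) - A(i, j),
-- which follows from Pascal's rule. The prime power formulas are the case d = 0, and the
-- formula for 2ᶜ qᵈ follows from the hockey-stick identity Σᵢ C(i+k, k) = C(c+k+1, k+1).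

module Submission where

open import Defs
open import Data.Nat.Primality using (Prime)
open import Relation.Binary.PropositionalEquality using (_≢_)

module Divisors where

  open import Data.Nat
  open import Data.Nat.Properties
  open import Data.Nat.Induction using (<′-wellFounded; <′-wellFounded′)
  open import Data.Nat.Divisibility
  open import Data.Nat.Primality using (Prime; euclidsLemma; prime⇒irreducible; prime⇒nonZero; ¬prime[1])
  open import Data.Nat.Coprimality using (Coprime; coprime-divisor)
  open import Data.Fin using (Fin; toℕ)
  open import Data.Fin.Properties using (toℕ<n)
  open import Data.Product using (∃₂; _×_; _,_)
  open import Data.Sum using (inj₁; inj₂)
  open import Data.Empty using (⊥-elim)
  open import Relation.Nullary using (¬_; yes; no)
  open import Relation.Binary.PropositionalEquality

  sumFin-cong : ∀ n {f g : Fin n → ℕ} → (∀ i → f i ≡ g i) → sumFin n f ≡ sumFin n g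
  sumFin-cong zero    f≗g = refl
  sumFin-cong (suc n) f≗g = cong₂ _+_ (f≗g Fin.zero) (sumFin-cong n (λ i → f≗g (Fin.suc i)))

  divisorTerm : (ℕ → ℕ) → ℕ → ℕ → ℕ
  divisorTerm g n m with m ∣? n
  ... | yes _ = g m
  ... | no  _ = 0

  divisorTerm-self : ∀ g n → divisorTerm g n n ≡ g n
  divisorTerm-self g n with n ∣? n
  ... | yes _   = refl
  ... | no  n∤n = ⊥-elim (n∤n ∣-refl)

  <′-wellFounded′-canonical : ∀ {n m} (m<n : m <′ n) → <′-wellFounded′ n m<n ≡ <′-wellFounded m
  <′-wellFounded′-canonical <′-base        = refl
  <′-wellFounded′-canonical (<′-step m<n) = <′-wellFounded′-canonical m<n

  -- The summands of b n are a where-bound with-function of Defs and cannot be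
  -- named, so the type of the pointwise equation is left to unification.
  BSummand≡ : (n : ℕ) → Fin n → Set
  b-summand≡ : ∀ n (i : Fin n) → BSummand≡ n i
  BSummand≡ = _

  b-unfold : ∀ n → b n ≡ n + sumFin n (λ i → divisorTerm b n (toℕ i))
  b-unfold n = cong (n +_) (sumFin-cong n (b-summand≡ n))

  -- A recursive call of b carries an accessibility proof of the form
  -- <′-wellFounded′ n _, which the rewrite turns into the one b itself uses.
  b-summand≡ n i with toℕ i ∣? n
  ... | no  _ = refl
  ... | yes _ rewrite <′-wellFounded′-canonical (<⇒<′ (toℕ<n i)) = refl

  ^-monoʳ-∣ : ∀ p {i c} → i ≤ c → p ^ i ∣ p ^ c
  ^-monoʳ-∣ p {i} {c} i≤c = divides (p ^ (c ∸ i)) (begin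
    p ^ c               ≡⟨ cong (p ^_) (sym (m∸n+n≡m i≤c)) ⟩
    p ^ (c ∸ i + i)     ≡⟨ ^-distribˡ-+-* p (c ∸ i) i ⟩
    p ^ (c ∸ i) * p ^ i ∎)
    where open ≡-Reasoning

  module _ {p} (p-prime : Prime p) where

    private instance
      p≢0 : NonZero p
      p≢0 = prime⇒nonZero p-prime

    ¬∣⇒coprime : ∀ {m} → ¬ p ∣ m → Coprime m p
    ¬∣⇒coprime p∤m (d∣m , d∣p) with prime⇒irreducible p-prime d∣p
    ... | inj₁ d≡1 = d≡1
    ... | inj₂ refl = ⊥-elim (p∤m d∣m)

    ∣prime^*⇒ : ∀ c {m x} → m ∣ p ^ c * x →
                ∃₂ λ i m′ → i ≤ c × m ≡ p ^ i * m′ × m′ ∣ x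
    ∣prime^*⇒ zero {m} {x} m∣x = 0 , m , z≤n , sym (+-identityʳ m) , subst (m ∣_) (+-identityʳ x) m∣x
    ∣prime^*⇒ (suc c) {m} {x} m∣pp^cx with p ∣? m
    ... | yes (divides k refl) =
      let (i , m′ , i≤c , k≡p^im′ , m′∣x) =
            ∣prime^*⇒ c (*-cancelˡ-∣ p (subst₂ _∣_ (*-comm k p) (*-assoc p (p ^ c) x) m∣pp^cx))
      in suc i , m′ , s≤s i≤c
       , trans (*-comm k p) (trans (cong (p *_) k≡p^im′) (sym (*-assoc p (p ^ i) m′)))
       , m′∣x
    ... | no p∤m =
      let (i , m′ , i≤c , m≡p^im′ , m′∣x) =
            ∣prime^*⇒ c (coprime-divisor (¬∣⇒coprime p∤m) (subst (m ∣_) (*-assoc p (p ^ c) x) m∣pp^cx))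
      in i , m′ , m≤n⇒m≤1+n i≤c , m≡p^im′ , m′∣x

    private
      p∣p^[1+i]* : ∀ i y → p ∣ p ^ suc i * y
      p∣p^[1+i]* i y = subst (p ∣_) (sym (*-assoc p (p ^ i) y)) (m∣m*n (p ^ i * y))

    prime^*-injective : ∀ i i′ {x x′} → ¬ p ∣ x → ¬ p ∣ x′ →
                        p ^ i * x ≡ p ^ i′ * x′ → i ≡ i′ × x ≡ x′
    prime^*-injective zero    zero     {x} {x′} _ _ eq =
      refl , trans (sym (*-identityˡ x)) (trans eq (*-identityˡ x′))
    prime^*-injective zero    (suc i′) {x} {x′} p∤x _ eq =
      ⊥-elim (p∤x (subst (p ∣_) (sym (trans (sym (*-identityˡ x)) eq)) (p∣p^[1+i]* i′ x′)))
    prime^*-injective (suc i) zero     {x} {x′} _ p∤x′ eq =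
      ⊥-elim (p∤x′ (subst (p ∣_) (trans eq (*-identityˡ x′)) (p∣p^[1+i]* i x)))
    prime^*-injective (suc i) (suc i′) {x} {x′} p∤x p∤x′ eq =
      let (i≡i′ , x≡x′) = prime^*-injective i i′ p∤x p∤x′
            (*-cancelˡ-≡ _ _ p (trans (sym (*-assoc p (p ^ i) x)) (trans eq (*-assoc p (p ^ i′) x′))))
      in cong suc i≡i′ , x≡x′

    prime∤prime^ : ∀ {q} → Prime q → p ≢ q → ∀ j → ¬ p ∣ q ^ j
    prime∤prime^ q-prime p≢q zero p∣1 = ¬prime[1] (subst Prime (∣1⇒≡1 p∣1) p-prime)
    prime∤prime^ {q} q-prime p≢q (suc j) p∣q^sj with euclidsLemma q (q ^ j) p-prime p∣q^sj
    ... | inj₂ p∣q^j = prime∤prime^ q-prime p≢q j p∣q^j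
    ... | inj₁ p∣q with prime⇒irreducible q-prime p∣q
    ...   | inj₁ p≡1 = ¬prime[1] (subst Prime p≡1 p-prime)
    ...   | inj₂ p≡q = p≢q p≡q

  module PrimePair {p q} (p-prime : Prime p) (q-prime : Prime q) (p≢q : p ≢ q) where

    monomial : ℕ → ℕ → ℕ
    monomial i j = p ^ i * q ^ j

    monomial≢0 : ∀ i j → NonZero (monomial i j)
    monomial≢0 i j = m*n≢0 (p ^ i) (q ^ j)
      {{m^n≢0 p i {{prime⇒nonZero p-prime}}}} {{m^n≢0 q j {{prime⇒nonZero q-prime}}}}

    monomial-suc₁ : ∀ i j → monomial (suc i) j ≡ p * monomial i j
    monomial-suc₁ i j = *-assoc p (p ^ i) (q ^ j)

    monomial-suc₂ : ∀ i j → monomial i (suc j) ≡ q * monomial i j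
    monomial-suc₂ i j = begin
      p ^ i * (q * q ^ j) ≡⟨ sym (*-assoc (p ^ i) q (q ^ j)) ⟩
      p ^ i * q * q ^ j   ≡⟨ cong (_* q ^ j) (*-comm (p ^ i) q) ⟩
      q * p ^ i * q ^ j   ≡⟨ *-assoc q (p ^ i) (q ^ j) ⟩
      q * (p ^ i * q ^ j) ∎
      where open ≡-Reasoning

    monomial-injective : ∀ i j i′ j′ → monomial i j ≡ monomial i′ j′ → i ≡ i′ × j ≡ j′
    monomial-injective i j i′ j′ eq =
      let (i≡i′ , q^j≡q^j′) = prime^*-injective p-prime i i′ (p∤q^ j) (p∤q^ j′) eq
          (j≡j′ , _) = prime^*-injective q-prime j j′ q∤1 q∤1
                         (trans (*-identityʳ (q ^ j)) (trans q^j≡q^j′ (sym (*-identityʳ (q ^ j′)))))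
      in i≡i′ , j≡j′
      where
      p∤q^ : ∀ j → ¬ p ∣ q ^ j
      p∤q^ = prime∤prime^ p-prime q-prime p≢q
      q∤1 : ¬ q ∣ 1
      q∤1 q∣1 = ¬prime[1] (subst Prime (∣1⇒≡1 q∣1) q-prime)

    monomial-mono-∣ : ∀ {i j c d} → i ≤ c → j ≤ d → monomial i j ∣ monomial c d
    monomial-mono-∣ i≤c j≤d = *-pres-∣ (^-monoʳ-∣ p i≤c) (^-monoʳ-∣ q j≤d)

    ∣monomial⇒ : ∀ c d {m} → m ∣ monomial c d → ∃₂ λ i j → i ≤ c × j ≤ d × m ≡ monomial i j
    ∣monomial⇒ c d {m} m∣M =
      let (i , m′ , i≤c , m≡p^im′ , m′∣q^d) = ∣prime^*⇒ p-prime c m∣M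
          (j , m″ , j≤d , m′≡q^jm″ , m″∣1) = ∣prime^*⇒ q-prime d (subst (m′ ∣_) (sym (*-identityʳ (q ^ d))) m′∣q^d)
      in i , j , i≤c , j≤d
       , trans m≡p^im′ (cong (p ^ i *_) (trans m′≡q^jm″ (trans (cong (q ^ j *_) (∣1⇒≡1 m″∣1)) (*-identityʳ (q ^ j)))))

module Rationals where

  open import Data.Nat as ℕ using (ℕ; zero; suc; z≤n)
  import Data.Nat.Properties as ℕ
  import Data.Integer as ℤ
  import Data.Integer.Properties as ℤ
  open import Data.Fin using (toℕ)
  open import Data.Rational
  open import Data.Rational.Properties
  import Data.Rational.Unnormalised as ℚᵘ
  import Data.Rational.Unnormalised.Properties as ℚᵘ
  open import Data.Rational.Solver using (module +-*-Solver)
  open +-*-Solver using (solve; _:+_; _:*_; _:=_; con)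
  open import Relation.Nullary using (yes; no)
  open import Data.Empty using (⊥-elim)
  open import Relation.Binary.PropositionalEquality

  private
    ℕ→ℚᵘ : ℕ → ℚᵘ.ℚᵘ
    ℕ→ℚᵘ n = ℚᵘ.mkℚᵘ (ℤ.+ n) 0

    toℚᵘ-ℕ→ℚ : ∀ n → toℚᵘ (ℕ→ℚ n) ℚᵘ.≃ ℕ→ℚᵘ n
    toℚᵘ-ℕ→ℚ n = toℚᵘ-fromℚᵘ (ℕ→ℚᵘ n)

    1/suc : ℕ → ℚ
    1/suc d = (ℤ.+ 1) / suc d

  ℕ→ℚ-homo-+ : ∀ m n → ℕ→ℚ (m ℕ.+ n) ≡ ℕ→ℚ m + ℕ→ℚ n
  ℕ→ℚ-homo-+ m n = toℚᵘ-injective (ℚᵘ.≃-trans (toℚᵘ-ℕ→ℚ (m ℕ.+ n)) (ℚᵘ.≃-trans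
    (ℚᵘ.*≡* (trans (ℤ.*-identityʳ _) (trans (ℤ.pos-+ m n) (sym (trans (ℤ.*-identityʳ _)
      (cong₂ ℤ._+_ (ℤ.*-identityʳ (ℤ.+ m)) (ℤ.*-identityʳ (ℤ.+ n))))))))
    (ℚᵘ.≃-sym (ℚᵘ.≃-trans (toℚᵘ-homo-+ (ℕ→ℚ m) (ℕ→ℚ n)) (ℚᵘ.+-cong (toℚᵘ-ℕ→ℚ m) (toℚᵘ-ℕ→ℚ n))))))

  ℕ→ℚ-homo-* : ∀ m n → ℕ→ℚ (m ℕ.* n) ≡ ℕ→ℚ m * ℕ→ℚ n
  ℕ→ℚ-homo-* m n = toℚᵘ-injective (ℚᵘ.≃-trans (toℚᵘ-ℕ→ℚ (m ℕ.* n)) (ℚᵘ.≃-trans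
    (ℚᵘ.*≡* (cong (ℤ._* ℤ.+ 1) (ℤ.pos-* m n)))
    (ℚᵘ.≃-sym (ℚᵘ.≃-trans (toℚᵘ-homo-* (ℕ→ℚ m) (ℕ→ℚ n)) (ℚᵘ.*-cong (toℚᵘ-ℕ→ℚ m) (toℚᵘ-ℕ→ℚ n))))))

  /ℕ≡*1/ℕ : ∀ x n → x /ℕ n ≡ x * (1ℚ /ℕ n)
  /ℕ≡*1/ℕ x zero    = sym (*-zeroʳ x)
  /ℕ≡*1/ℕ x (suc d) = cong (x *_) (sym (*-identityˡ (1/suc d)))

  1/ℕ-inverseˡ : ∀ n .{{_ : ℕ.NonZero n}} → (1ℚ /ℕ n) * ℕ→ℚ n ≡ 1ℚ
  1/ℕ-inverseˡ (suc d) = trans (cong (_* ℕ→ℚ (suc d)) (*-identityˡ (1/suc d))) (toℚᵘ-injective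
    (ℚᵘ.≃-trans (toℚᵘ-homo-* (1/suc d) (ℕ→ℚ (suc d)))
    (ℚᵘ.≃-trans (ℚᵘ.*-cong (toℚᵘ-fromℚᵘ (ℚᵘ.mkℚᵘ (ℤ.+ 1) d)) (toℚᵘ-ℕ→ℚ (suc d))) cross)))
    where
    cross : ℚᵘ.mkℚᵘ (ℤ.+ 1) d ℚᵘ.* ℕ→ℚᵘ (suc d) ℚᵘ.≃ toℚᵘ 1ℚ
    cross = ℚᵘ.*≡* (trans (ℤ.*-identityʳ _) (trans (ℤ.*-identityˡ _)
              (sym (trans (ℤ.*-identityˡ _) (cong ℤ.+_ (ℕ.*-identityʳ (suc d)))))))

  1/ℕ-homo-* : ∀ m n .{{_ : ℕ.NonZero m}} .{{_ : ℕ.NonZero n}} →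
               1ℚ /ℕ (m ℕ.* n) ≡ (1ℚ /ℕ m) * (1ℚ /ℕ n)
  1/ℕ-homo-* m n = begin
    1/mn
      ≡⟨ solve 3 (λ a u v → a := a :* (con 1ℚ :* con 1ℚ)) refl 1/mn (1ℚ /ℕ m) (1ℚ /ℕ n) ⟩
    1/mn * (1ℚ * 1ℚ)
      ≡⟨ cong (1/mn *_) (sym (cong₂ _*_ (1/ℕ-inverseˡ m) (1/ℕ-inverseˡ n))) ⟩
    1/mn * ((1ℚ /ℕ m * M) * (1ℚ /ℕ n * N))
      ≡⟨ solve 5 (λ a u v x y → a :* ((u :* x) :* (v :* y)) := (a :* (x :* y)) :* (u :* v)) refl 1/mn (1ℚ /ℕ m) (1ℚ /ℕ n) M N ⟩
    1/mn * (M * N) * (1ℚ /ℕ m * 1ℚ /ℕ n)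
      ≡⟨ cong (λ t → 1/mn * t * (1ℚ /ℕ m * 1ℚ /ℕ n)) (sym (ℕ→ℚ-homo-* m n)) ⟩
    1/mn * ℕ→ℚ (m ℕ.* n) * (1ℚ /ℕ m * 1ℚ /ℕ n)
      ≡⟨ cong (_* (1ℚ /ℕ m * 1ℚ /ℕ n)) (1/ℕ-inverseˡ (m ℕ.* n) {{ℕ.m*n≢0 m n}}) ⟩
    1ℚ * (1ℚ /ℕ m * 1ℚ /ℕ n)
      ≡⟨ *-identityˡ _ ⟩
    1ℚ /ℕ m * 1ℚ /ℕ n ∎
    where
    open ≡-Reasoning
    1/mn = 1ℚ /ℕ (m ℕ.* n)
    M = ℕ→ℚ m
    N = ℕ→ℚ n

  /ℕ-distrib-* : ∀ x y m n .{{_ : ℕ.NonZero m}} .{{_ : ℕ.NonZero n}} → (x * y) /ℕ (m ℕ.* n) ≡ (x /ℕ m) * (y /ℕ n)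
  /ℕ-distrib-* x y m n = begin
    (x * y) /ℕ (m ℕ.* n)                ≡⟨ /ℕ≡*1/ℕ (x * y) (m ℕ.* n) ⟩
    (x * y) * (1ℚ /ℕ (m ℕ.* n))         ≡⟨ cong ((x * y) *_) (1/ℕ-homo-* m n) ⟩
    (x * y) * (1ℚ /ℕ m * 1ℚ /ℕ n)       ≡⟨ solve 4 (λ x y u v → (x :* y) :* (u :* v) := (x :* u) :* (y :* v)) refl x y (1ℚ /ℕ m) (1ℚ /ℕ n) ⟩
    (x * 1ℚ /ℕ m) * (y * 1ℚ /ℕ n)       ≡⟨ sym (cong₂ _*_ (/ℕ≡*1/ℕ x m) (/ℕ≡*1/ℕ y n)) ⟩
    (x /ℕ m) * (y /ℕ n)                 ∎
    where open ≡-Reasoning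

  *-cancel-1/ℕ : ∀ x n .{{_ : ℕ.NonZero n}} → (ℕ→ℚ n * x) * (1ℚ /ℕ n) ≡ x
  *-cancel-1/ℕ x n = begin
    (ℕ→ℚ n * x) * (1ℚ /ℕ n)  ≡⟨ solve 3 (λ n x u → (n :* x) :* u := x :* (u :* n)) refl (ℕ→ℚ n) x (1ℚ /ℕ n) ⟩
    x * ((1ℚ /ℕ n) * ℕ→ℚ n)  ≡⟨ cong (x *_) (1/ℕ-inverseˡ n) ⟩
    x * 1ℚ                   ≡⟨ *-identityʳ x ⟩
    x                        ∎
    where open ≡-Reasoning

  n/ℕn≡1 : ∀ n .{{_ : ℕ.NonZero n}} → ℕ→ℚ n /ℕ n ≡ 1ℚ
  n/ℕn≡1 n = trans (/ℕ≡*1/ℕ (ℕ→ℚ n) n) (trans (*-comm (ℕ→ℚ n) (1ℚ /ℕ n)) (1/ℕ-inverseˡ n))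

  ^/ℕ^-suc : ∀ m n i .{{_ : ℕ.NonZero n}} →
             ℕ→ℚ (m ℕ.^ suc i) /ℕ (n ℕ.^ suc i) ≡ (ℕ→ℚ m * (1ℚ /ℕ n)) * (ℕ→ℚ (m ℕ.^ i) /ℕ (n ℕ.^ i))
  ^/ℕ^-suc m n i {{n≢0}} = begin
    ℕ→ℚ (m ℕ.* m ℕ.^ i) /ℕ (n ℕ.* n ℕ.^ i)
      ≡⟨ cong (_/ℕ (n ℕ.* n ℕ.^ i)) (ℕ→ℚ-homo-* m (m ℕ.^ i)) ⟩
    (ℕ→ℚ m * ℕ→ℚ (m ℕ.^ i)) /ℕ (n ℕ.* n ℕ.^ i)
      ≡⟨ /ℕ-distrib-* (ℕ→ℚ m) (ℕ→ℚ (m ℕ.^ i)) n (n ℕ.^ i) {{n≢0}} {{ℕ.m^n≢0 n i {{n≢0}}}} ⟩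
    (ℕ→ℚ m /ℕ n) * (ℕ→ℚ (m ℕ.^ i) /ℕ (n ℕ.^ i))
      ≡⟨ cong (_* (ℕ→ℚ (m ℕ.^ i) /ℕ (n ℕ.^ i))) (/ℕ≡*1/ℕ (ℕ→ℚ m) n) ⟩
    (ℕ→ℚ m * (1ℚ /ℕ n)) * (ℕ→ℚ (m ℕ.^ i) /ℕ (n ℕ.^ i)) ∎
    where open ≡-Reasoning

  sumTo-cong : ∀ n {f g : ℕ → ℚ} → (∀ i → i ℕ.≤ n → f i ≡ g i) → sumTo n f ≡ sumTo n g
  sumTo-cong zero    f≗g = f≗g 0 z≤n
  sumTo-cong (suc n) f≗g = cong₂ _+_ (sumTo-cong n (λ i i≤n → f≗g i (ℕ.m≤n⇒m≤1+n i≤n))) (f≗g (suc n) ℕ.≤-refl)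

  sumTo-distrib-+ : ∀ n (f g : ℕ → ℚ) → sumTo n (λ i → f i + g i) ≡ sumTo n f + sumTo n g
  sumTo-distrib-+ zero    f g = refl
  sumTo-distrib-+ (suc n) f g = trans (cong (_+ (f (suc n) + g (suc n))) (sumTo-distrib-+ n f g))
    (solve 4 (λ a b c d → (a :+ b) :+ (c :+ d) := (a :+ c) :+ (b :+ d)) refl (sumTo n f) (sumTo n g) (f (suc n)) (g (suc n)))

  *-distribˡ-sumTo : ∀ n a (f : ℕ → ℚ) → a * sumTo n f ≡ sumTo n (λ i → a * f i)
  *-distribˡ-sumTo zero    a f = refl
  *-distribˡ-sumTo (suc n) a f = trans (*-distribˡ-+ a (sumTo n f) (f (suc n))) (cong (_+ a * f (suc n)) (*-distribˡ-sumTo n a f))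

  sumTo-comm : ∀ m n (F : ℕ → ℕ → ℚ) → sumTo m (λ i → sumTo n (F i)) ≡ sumTo n (λ j → sumTo m (λ i → F i j))
  sumTo-comm zero    n F = refl
  sumTo-comm (suc m) n F = trans (cong (_+ sumTo n (F (suc m))) (sumTo-comm m n F))
    (sym (sumTo-distrib-+ n (λ j → sumTo m (λ i → F i j)) (F (suc m))))

  sumTo-suc : ∀ n (f : ℕ → ℚ) → sumTo (suc n) f ≡ f 0 + sumTo n (λ i → f (suc i))
  sumTo-suc zero    f = refl
  sumTo-suc (suc n) f = trans (cong (_+ f (suc (suc n))) (sumTo-suc n f)) (+-assoc (f 0) _ _)

  sumTo-zero : ∀ n {f : ℕ → ℚ} → (∀ i → i ℕ.≤ n → f i ≡ 0ℚ) → sumTo n f ≡ 0ℚ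
  sumTo-zero zero    f≗0 = f≗0 0 z≤n
  sumTo-zero (suc n) f≗0 = cong₂ _+_ (sumTo-zero n (λ i i≤n → f≗0 i (ℕ.m≤n⇒m≤1+n i≤n))) (f≗0 (suc n) ℕ.≤-refl)

  sumTo-single : ∀ n {f : ℕ → ℚ} i₀ → i₀ ℕ.≤ n → (∀ i → i ℕ.≤ n → i ≢ i₀ → f i ≡ 0ℚ) → sumTo n f ≡ f i₀
  sumTo-single zero    .0 z≤n _ = refl
  sumTo-single (suc n) {f} i₀ i₀≤1+n f≗0 with i₀ ℕ.≟ suc n
  ... | yes refl = trans (cong (_+ f (suc n)) (sumTo-zero n (λ i i≤n →
                     f≗0 i (ℕ.m≤n⇒m≤1+n i≤n) (λ { refl → ℕ.<-irrefl refl i≤n }))))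
                   (+-identityˡ (f (suc n)))
  ... | no i₀≢1+n = trans (cong₂ _+_ (sumTo-single n i₀ (ℕ.≤-pred (ℕ.≤∧≢⇒< i₀≤1+n i₀≢1+n))
                                                         (λ i i≤n → f≗0 i (ℕ.m≤n⇒m≤1+n i≤n)))
                            (f≗0 (suc n) ℕ.≤-refl (λ 1+n≡i₀ → i₀≢1+n (sym 1+n≡i₀))))
                    (+-identityʳ (f i₀))

  sumTo-1 : ∀ n → sumTo n (λ _ → 1ℚ) ≡ ℕ→ℚ (suc n)
  sumTo-1 zero    = refl
  sumTo-1 (suc n) = trans (cong (_+ 1ℚ) (sumTo-1 n)) (sym (trans (cong ℕ→ℚ (ℕ.+-comm 1 (suc n))) (ℕ→ℚ-homo-+ (suc n) 1)))

  ℕ→ℚ-sumFin : ∀ n (g : ℕ → ℕ) → ℕ→ℚ (sumFin n (λ i → g (toℕ i))) + ℕ→ℚ (g n) ≡ sumTo n (λ i → ℕ→ℚ (g i))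
  ℕ→ℚ-sumFin zero    g = +-identityˡ (ℕ→ℚ (g 0))
  ℕ→ℚ-sumFin (suc n) g = begin
    ℕ→ℚ (g 0 ℕ.+ sumFin n (λ i → g (suc (toℕ i)))) + ℕ→ℚ (g (suc n))
      ≡⟨ cong (_+ ℕ→ℚ (g (suc n))) (ℕ→ℚ-homo-+ (g 0) _) ⟩
    ℕ→ℚ (g 0) + ℕ→ℚ (sumFin n (λ i → g (suc (toℕ i)))) + ℕ→ℚ (g (suc n))
      ≡⟨ +-assoc (ℕ→ℚ (g 0)) _ _ ⟩
    ℕ→ℚ (g 0) + (ℕ→ℚ (sumFin n (λ i → g (suc (toℕ i)))) + ℕ→ℚ (g (suc n)))
      ≡⟨ cong (ℕ→ℚ (g 0) +_) (ℕ→ℚ-sumFin n (λ i → g (suc i))) ⟩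
    ℕ→ℚ (g 0) + sumTo n (λ i → ℕ→ℚ (g (suc i)))
      ≡⟨ sym (sumTo-suc n (λ i → ℕ→ℚ (g i))) ⟩
    sumTo (suc n) (λ i → ℕ→ℚ (g i)) ∎
    where open ≡-Reasoning

  ifEq : ℕ → ℕ → ℚ → ℚ
  ifEq m v x with m ℕ.≟ v
  ... | yes _ = x
  ... | no  _ = 0ℚ

  ifEq-≢ : ∀ m v x → m ≢ v → ifEq m v x ≡ 0ℚ
  ifEq-≢ m v x m≢v with m ℕ.≟ v
  ... | yes m≡v = ⊥-elim (m≢v m≡v)
  ... | no  _   = refl

  ifEq-≡ : ∀ m v x → m ≡ v → ifEq m v x ≡ x
  ifEq-≡ m v x m≡v with m ℕ.≟ v
  ... | yes _   = refl
  ... | no  m≢v = ⊥-elim (m≢v m≡v)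

  sumTo-ifEq : ∀ M v (h : ℕ → ℚ) → v ℕ.≤ M → sumTo M (λ m → ifEq m v (h m)) ≡ h v
  sumTo-ifEq M v h v≤M = trans (sumTo-single M v v≤M (λ m _ → ifEq-≢ m v (h m))) (ifEq-≡ v v (h v) refl)

module BinomialSums where

  open Rationals
  open import Data.Nat as ℕ using (ℕ; zero; suc)
  import Data.Nat.Properties as ℕ
  open import Data.Nat.Combinatorics using (_C_; k>n⇒nCk≡0; nCk+nC[k+1]≡[n+1]C[k+1]; nCn≡1)
  open import Data.Rational
  open import Data.Rational.Properties
  open import Data.Rational.Solver using (module +-*-Solver)
  open +-*-Solver using (solve; _:+_; _:*_; _:-_; _:=_; con)
  open import Relation.Binary.PropositionalEquality
  open import Data.Nat.Tactic.RingSolver using (solve-∀)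

  hockey-stick : ∀ c k → sumTo c (λ i → ℕ→ℚ ((i ℕ.+ k) C k)) ≡ ℕ→ℚ ((c ℕ.+ k ℕ.+ 1) C (k ℕ.+ 1))
  hockey-stick zero    k = cong ℕ→ℚ (trans (nCn≡1 k) (sym (nCn≡1 (k ℕ.+ 1))))
  hockey-stick (suc c) k = begin
    sumTo c (λ i → ℕ→ℚ ((i ℕ.+ k) C k)) + ℕ→ℚ (n C k)   ≡⟨ cong (_+ ℕ→ℚ (n C k)) (hockey-stick c k) ⟩
    ℕ→ℚ ((c ℕ.+ k ℕ.+ 1) C (k ℕ.+ 1)) + ℕ→ℚ (n C k)      ≡⟨ sym (ℕ→ℚ-homo-+ ((c ℕ.+ k ℕ.+ 1) C (k ℕ.+ 1)) (n C k)) ⟩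
    ℕ→ℚ ((c ℕ.+ k ℕ.+ 1) C (k ℕ.+ 1) ℕ.+ n C k)          ≡⟨ cong ℕ→ℚ pascal ⟩
    ℕ→ℚ ((suc c ℕ.+ k ℕ.+ 1) C (k ℕ.+ 1))                ∎
    where
    open ≡-Reasoning
    n = suc (c ℕ.+ k)
    pascal : (c ℕ.+ k ℕ.+ 1) C (k ℕ.+ 1) ℕ.+ n C k ≡ (suc c ℕ.+ k ℕ.+ 1) C (k ℕ.+ 1)
    pascal = begin
      (c ℕ.+ k ℕ.+ 1) C (k ℕ.+ 1) ℕ.+ n C k ≡⟨ cong₂ (λ u v → u C v ℕ.+ n C k) (ℕ.+-comm (c ℕ.+ k) 1) (ℕ.+-comm k 1) ⟩
      n C suc k ℕ.+ n C k                   ≡⟨ ℕ.+-comm (n C suc k) (n C k) ⟩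
      n C k ℕ.+ n C suc k                   ≡⟨ nCk+nC[k+1]≡[n+1]C[k+1] n k ⟩
      suc n C suc k                         ≡⟨ cong₂ _C_ (cong suc (ℕ.+-comm 1 (c ℕ.+ k))) (ℕ.+-comm 1 k) ⟩
      (suc c ℕ.+ k ℕ.+ 1) C (k ℕ.+ 1)       ∎

  binomialSum : ℕ → ℕ → ℚ
  binomialSum i j = sumTo j (λ k → ℕ→ℚ (((i ℕ.+ k) C k) ℕ.* (j C k)))

  private
    sumTo-ℕ→ℚ-+ : ∀ n (f g : ℕ → ℕ) →
                  sumTo n (λ k → ℕ→ℚ (f k ℕ.+ g k)) ≡ sumTo n (λ k → ℕ→ℚ (f k)) + sumTo n (λ k → ℕ→ℚ (g k))
    sumTo-ℕ→ℚ-+ n f g = trans (sumTo-cong n (λ k _ → ℕ→ℚ-homo-+ (f k) (g k))) (sumTo-distrib-+ n _ _)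

    diagonal-pascal : ∀ i k → (suc i ℕ.+ suc k) C suc k ≡ (i ℕ.+ suc k) C suc k ℕ.+ (suc i ℕ.+ k) C k
    diagonal-pascal i k = begin
      suc (i ℕ.+ suc k) C suc k                            ≡⟨ sym (nCk+nC[k+1]≡[n+1]C[k+1] (i ℕ.+ suc k) k) ⟩
      (i ℕ.+ suc k) C k ℕ.+ (i ℕ.+ suc k) C suc k          ≡⟨ ℕ.+-comm ((i ℕ.+ suc k) C k) _ ⟩
      (i ℕ.+ suc k) C suc k ℕ.+ (i ℕ.+ suc k) C k          ≡⟨ cong (λ n → (i ℕ.+ suc k) C suc k ℕ.+ n C k) (ℕ.+-suc i k) ⟩
      (i ℕ.+ suc k) C suc k ℕ.+ (suc i ℕ.+ k) C k          ∎
      where open ≡-Reasoning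

    binomialSum-shift : ∀ i j →
      binomialSum i j ≡ 1ℚ + sumTo j (λ k → ℕ→ℚ (((i ℕ.+ suc k) C suc k) ℕ.* (j C suc k)))
    binomialSum-shift i j = begin
      sumTo j t                  ≡⟨ sym (+-identityʳ (sumTo j t)) ⟩
      sumTo j t + 0ℚ             ≡⟨ cong (sumTo j t +_) (sym last≡0) ⟩
      sumTo (suc j) t            ≡⟨ sumTo-suc j t ⟩
      1ℚ + sumTo j (λ k → t (suc k)) ∎
      where
      open ≡-Reasoning
      t = λ k → ℕ→ℚ (((i ℕ.+ k) C k) ℕ.* (j C k))
      last≡0 : t (suc j) ≡ 0ℚ
      last≡0 = cong ℕ→ℚ (trans (cong (((i ℕ.+ suc j) C suc j) ℕ.*_) (k>n⇒nCk≡0 (ℕ.n<1+n j))) (ℕ.*-zeroʳ ((i ℕ.+ suc j) C suc j)))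

    binomialSum-suc-shift : ∀ i j →
      binomialSum i (suc j) ≡ 1ℚ + sumTo j (λ k → ℕ→ℚ (((i ℕ.+ suc k) C suc k) ℕ.* (j C suc k ℕ.+ j C k)))
    binomialSum-suc-shift i j = trans (sumTo-suc j _) (cong (1ℚ +_) (sumTo-cong j (λ k _ →
      cong (λ n → ℕ→ℚ (((i ℕ.+ suc k) C suc k) ℕ.* n))
           (trans (sym (nCk+nC[k+1]≡[n+1]C[k+1] j k)) (ℕ.+-comm (j C k) (j C suc k))))))

  binomialSum-suc-suc : ∀ i j → binomialSum (suc i) (suc j) ≡ binomialSum i (suc j) + ℕ→ℚ 2 * binomialSum (suc i) j - binomialSum i j
  binomialSum-suc-suc i j = begin
    A (suc i) (suc j)
      ≡⟨ solve 2 (λ x y → x := (x :+ y) :- y) refl (A (suc i) (suc j)) (A i j) ⟩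
    (A (suc i) (suc j) + A i j) - A i j
      ≡⟨ cong (_- A i j) (cong₂ _+_ (binomialSum-suc-shift (suc i) j) (binomialSum-shift i j)) ⟩
    ((1ℚ + Σ X) + (1ℚ + Σ Y)) - A i j
      ≡⟨ cong (_- A i j) (solve 2 (λ x y → (con 1ℚ :+ x) :+ (con 1ℚ :+ y) := con 1ℚ :+ (con 1ℚ :+ (x :+ y))) refl (Σ X) (Σ Y)) ⟩
    (1ℚ + (1ℚ + (Σ X + Σ Y))) - A i j
      ≡⟨ cong (λ s → (1ℚ + (1ℚ + s)) - A i j) regroup ⟩
    (1ℚ + (1ℚ + (Σ Z + (Σ W + Σ V)))) - A i j
      ≡⟨ cong (_- A i j) (solve 3 (λ z w v → con 1ℚ :+ (con 1ℚ :+ (z :+ (w :+ v))) := (con 1ℚ :+ z) :+ (w :+ (con 1ℚ :+ v)))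
                                  refl (Σ Z) (Σ W) (Σ V)) ⟩
    ((1ℚ + Σ Z) + (Σ W + (1ℚ + Σ V))) - A i j
      ≡⟨ cong (_- A i j) (cong₂ _+_ (sym (binomialSum-suc-shift i j)) (cong (Σ W +_) (sym (binomialSum-shift (suc i) j)))) ⟩
    (A i (suc j) + (A (suc i) j + A (suc i) j)) - A i j
      ≡⟨ solve 3 (λ x y z → (x :+ (y :+ y)) :- z := x :+ con (ℕ→ℚ 2) :* y :- z) refl (A i (suc j)) (A (suc i) j) (A i j) ⟩
    A i (suc j) + ℕ→ℚ 2 * A (suc i) j - A i j ∎
    where
    open ≡-Reasoning
    A = binomialSum
    Σ : (ℕ → ℕ) → ℚ
    Σ f = sumTo j (λ k → ℕ→ℚ (f k))
    a a′ B₀ B₁ : ℕ → ℕ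
    a k  = (i ℕ.+ suc k) C suc k
    a′ k = (suc i ℕ.+ k) C k
    B₀ k = j C k
    B₁ k = j C suc k
    X Y Z W V : ℕ → ℕ
    X k = a′ (suc k) ℕ.* (B₁ k ℕ.+ B₀ k)
    Y k = a k ℕ.* B₁ k
    Z k = a k ℕ.* (B₁ k ℕ.+ B₀ k)
    W k = a′ k ℕ.* B₀ k
    V k = a′ (suc k) ℕ.* B₁ k
    termwise : ∀ k → X k ℕ.+ Y k ≡ Z k ℕ.+ (W k ℕ.+ V k)
    termwise k rewrite diagonal-pascal i k = distrib-regroup (a k) (a′ k) (B₁ k) (B₀ k)
      where
      distrib-regroup : ∀ s t u v → (s ℕ.+ t) ℕ.* (u ℕ.+ v) ℕ.+ s ℕ.* u ≡ s ℕ.* (u ℕ.+ v) ℕ.+ (t ℕ.* v ℕ.+ (s ℕ.+ t) ℕ.* u)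
      distrib-regroup = solve-∀
    regroup : Σ X + Σ Y ≡ Σ Z + (Σ W + Σ V)
    regroup = begin
      Σ X + Σ Y                             ≡⟨ sym (sumTo-ℕ→ℚ-+ j X Y) ⟩
      Σ (λ k → X k ℕ.+ Y k)                 ≡⟨ sumTo-cong j (λ k _ → cong ℕ→ℚ (termwise k)) ⟩
      Σ (λ k → Z k ℕ.+ (W k ℕ.+ V k))       ≡⟨ sumTo-ℕ→ℚ-+ j Z _ ⟩
      Σ Z + Σ (λ k → W k ℕ.+ V k)           ≡⟨ cong (Σ Z +_) (sumTo-ℕ→ℚ-+ j W V) ⟩
      Σ Z + (Σ W + Σ V)                     ∎

  binomialSum-zero-suc : ∀ j → binomialSum 0 (suc j) ≡ ℕ→ℚ 2 * binomialSum 0 j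
  binomialSum-zero-suc j = begin
    binomialSum 0 (suc j)
      ≡⟨ binomialSum-suc-shift 0 j ⟩
    1ℚ + Σ (λ k → (suc k C suc k) ℕ.* (B₁ k ℕ.+ B₀ k))
      ≡⟨ cong (1ℚ +_) (trans (sumTo-cong j (λ k _ → cong ℕ→ℚ (termwise k))) (sumTo-ℕ→ℚ-+ j Y W)) ⟩
    1ℚ + (Σ Y + Σ W)
      ≡⟨ sym (+-assoc 1ℚ (Σ Y) (Σ W)) ⟩
    (1ℚ + Σ Y) + Σ W
      ≡⟨ cong (_+ Σ W) (sym (binomialSum-shift 0 j)) ⟩
    binomialSum 0 j + binomialSum 0 j
      ≡⟨ solve 1 (λ x → x :+ x := con (ℕ→ℚ 2) :* x) refl (binomialSum 0 j) ⟩
    ℕ→ℚ 2 * binomialSum 0 j ∎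
    where
    open ≡-Reasoning
    Σ : (ℕ → ℕ) → ℚ
    Σ f = sumTo j (λ k → ℕ→ℚ (f k))
    B₀ B₁ Y W : ℕ → ℕ
    B₀ k = j C k
    B₁ k = j C suc k
    Y k = (suc k C suc k) ℕ.* B₁ k
    W k = (k C k) ℕ.* B₀ k
    termwise : ∀ k → (suc k C suc k) ℕ.* (B₁ k ℕ.+ B₀ k) ≡ Y k ℕ.+ W k
    termwise k = trans (ℕ.*-distribˡ-+ (suc k C suc k) (B₁ k) (B₀ k))
                       (cong (λ n → Y k ℕ.+ n ℕ.* B₀ k) (trans (nCn≡1 (suc k)) (sym (nCn≡1 k))))

module DoubleSequences where

  open Rationals
  open import Data.Nat as ℕ using (ℕ; zero; suc; _∸_)
  open import Data.Rational
  open import Data.Rational.Properties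
  open import Data.Rational.Solver using (module +-*-Solver)
  open +-*-Solver using (solve; _:+_; _:*_; _:-_; _:=_; con)
  open import Relation.Binary.PropositionalEquality

  Seq₂ : Set
  Seq₂ = ℕ → ℕ → ℚ

  infix 4 _≗₂_
  _≗₂_ : Seq₂ → Seq₂ → Set
  h ≗₂ h′ = ∀ c d → h c d ≡ h′ c d

  -- Multiplying by isSuc c instead of matching on c makes every identity
  -- about the shifts below a single ring identity.
  isSuc : ℕ → ℚ
  isSuc zero    = 0ℚ
  isSuc (suc _) = 1ℚ

  shift₁ shift₂ : Seq₂ → Seq₂
  shift₁ h c d = isSuc c * h (c ∸ 1) d
  shift₂ h c d = isSuc d * h c (d ∸ 1)

  Op : ℚ → ℚ → ℚ → Seq₂ → Seq₂
  Op a b g h c d = h c d - a * shift₁ h c d - b * shift₂ h c d + g * shift₁ (shift₂ h) c d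

  Δ : Seq₂ → Seq₂
  Δ = Op 1ℚ 1ℚ 1ℚ

  partialSum : Seq₂ → Seq₂
  partialSum h c d = sumTo c (λ i → sumTo d (h i))

  one : Seq₂
  one _ _ = 1ℚ

  corner : Seq₂
  corner zero    zero    = 1ℚ
  corner zero    (suc _) = 0ℚ
  corner (suc _) _       = 0ℚ

  Op-cong : ∀ a b g {h h′} → h ≗₂ h′ → Op a b g h ≗₂ Op a b g h′
  Op-cong a b g h≗h′ c d =
    cong₂ _+_ (cong₂ _-_ (cong₂ _-_ (h≗h′ c d) (cong (λ v → a * (isSuc c * v)) (h≗h′ (c ∸ 1) d)))
                         (cong (λ v → b * (isSuc d * v)) (h≗h′ c (d ∸ 1))))
              (cong (λ v → g * (isSuc c * (isSuc d * v))) (h≗h′ (c ∸ 1) (d ∸ 1)))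

  private
    0*≡0* : ∀ (u v : ℚ) → 0ℚ * u ≡ 0ℚ * v
    0*≡0* u v = trans (*-zeroˡ u) (sym (*-zeroˡ v))

  -- Op a b g h c d is h c d plus a combination of values of h at smaller indices.
  Op-injective : ∀ a b g {h h′} → Op a b g h ≗₂ Op a b g h′ → h ≗₂ h′
  Op-injective a b g {h} {h′} Oh≗Oh′ = go
    where
    recover : ∀ (x a s b t g u : ℚ) → x ≡ (x - a * s - b * t + g * u) + a * s + b * t - g * u
    recover = solve 7 (λ x a s b t g u → x := (x :- a :* s :- b :* t :+ g :* u) :+ a :* s :+ b :* t :- g :* u) refl
    from-shifts : ∀ c d → shift₁ h c d ≡ shift₁ h′ c d → shift₂ h c d ≡ shift₂ h′ c d →
                  shift₁ (shift₂ h) c d ≡ shift₁ (shift₂ h′) c d → h c d ≡ h′ c d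
    from-shifts c d e₁ e₂ e₁₂ = begin
      h c d                                                                          ≡⟨ recover (h c d) a _ b _ g _ ⟩
      Op a b g h c d + a * shift₁ h c d + b * shift₂ h c d - g * shift₁ (shift₂ h) c d
        ≡⟨ cong₂ _-_ (cong₂ _+_ (cong₂ _+_ (Oh≗Oh′ c d) (cong (a *_) e₁)) (cong (b *_) e₂)) (cong (g *_) e₁₂) ⟩
      Op a b g h′ c d + a * shift₁ h′ c d + b * shift₂ h′ c d - g * shift₁ (shift₂ h′) c d
                                                                                     ≡⟨ sym (recover (h′ c d) a _ b _ g _) ⟩
      h′ c d                                                                         ∎
      where open ≡-Reasoning
    go : h ≗₂ h′
    go zero    zero    = from-shifts 0 0 (0*≡0* (h 0 0) (h′ 0 0)) (0*≡0* (h 0 0) (h′ 0 0)) (0*≡0* (shift₂ h 0 0) (shift₂ h′ 0 0))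
    go zero    (suc d) = from-shifts 0 (suc d) (0*≡0* (h 0 (suc d)) (h′ 0 (suc d))) (cong (1ℚ *_) (go zero d))
                                     (0*≡0* (shift₂ h 0 (suc d)) (shift₂ h′ 0 (suc d)))
    go (suc c) zero    = from-shifts (suc c) 0 (cong (1ℚ *_) (go c zero)) (0*≡0* (h (suc c) 0) (h′ (suc c) 0))
                                     (cong (1ℚ *_) (0*≡0* (h c 0) (h′ c 0)))
    go (suc c) (suc d) = from-shifts (suc c) (suc d) (cong (1ℚ *_) (go c (suc d))) (cong (1ℚ *_) (go (suc c) d))
                                     (cong (λ v → 1ℚ * (1ℚ * v)) (go c d))

  Op-comm : ∀ a b g a′ b′ g′ h → Op a b g (Op a′ b′ g′ h) ≗₂ Op a′ b′ g′ (Op a b g h)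
  Op-comm a b g a′ b′ g′ h c d =
    solve 19 (λ a b g a′ b′ g′ ι₁ ι₂ ι₁′ ι₂′ h00 h10 h01 h11 h20 h02 h21 h12 h22 →
       (h00 :- a′ :* (ι₁ :* h10) :- b′ :* (ι₂ :* h01) :+ g′ :* (ι₁ :* (ι₂ :* h11)))
       :- a :* (ι₁ :* (h10 :- a′ :* (ι₁′ :* h20) :- b′ :* (ι₂ :* h11) :+ g′ :* (ι₁′ :* (ι₂ :* h21))))
       :- b :* (ι₂ :* (h01 :- a′ :* (ι₁ :* h11) :- b′ :* (ι₂′ :* h02) :+ g′ :* (ι₁ :* (ι₂′ :* h12))))
       :+ g :* (ι₁ :* (ι₂ :* (h11 :- a′ :* (ι₁′ :* h21) :- b′ :* (ι₂′ :* h12) :+ g′ :* (ι₁′ :* (ι₂′ :* h22)))))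
       :=
       (h00 :- a :* (ι₁ :* h10) :- b :* (ι₂ :* h01) :+ g :* (ι₁ :* (ι₂ :* h11)))
       :- a′ :* (ι₁ :* (h10 :- a :* (ι₁′ :* h20) :- b :* (ι₂ :* h11) :+ g :* (ι₁′ :* (ι₂ :* h21))))
       :- b′ :* (ι₂ :* (h01 :- a :* (ι₁ :* h11) :- b :* (ι₂′ :* h02) :+ g :* (ι₁ :* (ι₂′ :* h12))))
       :+ g′ :* (ι₁ :* (ι₂ :* (h11 :- a :* (ι₁′ :* h21) :- b :* (ι₂′ :* h12) :+ g :* (ι₁′ :* (ι₂′ :* h22))))))
     refl a b g a′ b′ g′ (isSuc c) (isSuc d) (isSuc (c ∸ 1)) (isSuc (d ∸ 1))
     (h c d) (h (c ∸ 1) d) (h c (d ∸ 1)) (h (c ∸ 1) (d ∸ 1)) (h (c ∸ 1 ∸ 1) d) (h c (d ∸ 1 ∸ 1))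
     (h (c ∸ 1 ∸ 1) (d ∸ 1)) (h (c ∸ 1) (d ∸ 1 ∸ 1)) (h (c ∸ 1 ∸ 1) (d ∸ 1 ∸ 1))

  Δ-partialSum : ∀ h → Δ (partialSum h) ≗₂ h
  Δ-partialSum h zero    zero    =
    solve 1 (λ x → x :- con 1ℚ :* (con 0ℚ :* x) :- con 1ℚ :* (con 0ℚ :* x) :+ con 1ℚ :* (con 0ℚ :* (con 0ℚ :* x))
                   := x)
      refl (h 0 0)
  Δ-partialSum h zero    (suc d) =
    solve 2 (λ s x → (s :+ x) :- con 1ℚ :* (con 0ℚ :* (s :+ x)) :- con 1ℚ :* (con 1ℚ :* s)
                     :+ con 1ℚ :* (con 0ℚ :* (con 1ℚ :* s)) := x)
      refl (sumTo d (h 0)) (h 0 (suc d))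
  Δ-partialSum h (suc c) zero    =
    solve 2 (λ s x → (s :+ x) :- con 1ℚ :* (con 1ℚ :* s) :- con 1ℚ :* (con 0ℚ :* (s :+ x))
                     :+ con 1ℚ :* (con 1ℚ :* (con 0ℚ :* s)) := x)
      refl (partialSum h c 0) (h (suc c) 0)
  Δ-partialSum h (suc c) (suc d) = begin
    Δ (partialSum h) (suc c) (suc d)
      ≡⟨ cong₂ (λ u v → u + (R + x) - 1ℚ * (1ℚ * v) - 1ℚ * (1ℚ * (S + R)) + 1ℚ * (1ℚ * (1ℚ * S))) split split ⟩
    (S + C) + (R + x) - 1ℚ * (1ℚ * (S + C)) - 1ℚ * (1ℚ * (S + R)) + 1ℚ * (1ℚ * (1ℚ * S))
      ≡⟨ solve 4 (λ S C R x → (S :+ C) :+ (R :+ x) :- con 1ℚ :* (con 1ℚ :* (S :+ C)) :- con 1ℚ :* (con 1ℚ :* (S :+ R))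
                              :+ con 1ℚ :* (con 1ℚ :* (con 1ℚ :* S)) := x)
           refl S C R x ⟩
    x ∎
    where
    open ≡-Reasoning
    S = partialSum h c d
    C = sumTo c (λ i → h i (suc d))
    R = sumTo d (h (suc c))
    x = h (suc c) (suc d)
    split : sumTo c (λ i → sumTo (suc d) (h i)) ≡ S + C
    split = sumTo-distrib-+ c (λ i → sumTo d (h i)) (λ i → h i (suc d))

  Δ-one : Δ one ≗₂ corner
  Δ-one zero    zero    = refl
  Δ-one zero    (suc d) = refl
  Δ-one (suc c) zero    = refl
  Δ-one (suc c) (suc d) = refl

  -- Apply Δ, which commutes with Op, inverts partialSum and maps one to corner.
  partialSum-of-impulse : ∀ a b g h → Op a b g h ≗₂ corner → Op a b g (partialSum h) ≗₂ one
  partialSum-of-impulse a b g h Oh≗corner = Op-injective 1ℚ 1ℚ 1ℚ (λ c d → begin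
    Δ (Op a b g (partialSum h)) c d ≡⟨ Op-comm 1ℚ 1ℚ 1ℚ a b g (partialSum h) c d ⟩
    Op a b g (Δ (partialSum h)) c d ≡⟨ Op-cong a b g (Δ-partialSum h) c d ⟩
    Op a b g h c d                  ≡⟨ Oh≗corner c d ⟩
    corner c d                      ≡⟨ sym (Δ-one c d) ⟩
    Δ one c d                       ∎)
    where open ≡-Reasoning

  -- Apply Δ, which inverts partialSum.
  recurrence⇒Op : ∀ N h → (∀ c d → h c d + h c d ≡ N c d + partialSum h c d) →
                  Op (ℕ→ℚ 2) (ℕ→ℚ 2) (ℕ→ℚ 2) h ≗₂ Δ N
  recurrence⇒Op N h rec c d = begin
    Op (ℕ→ℚ 2) (ℕ→ℚ 2) (ℕ→ℚ 2) h c d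
      ≡⟨ solve 6 (λ ι₁ ι₂ x x₁₀ x₀₁ x₁₁ →
           x :- con (ℕ→ℚ 2) :* (ι₁ :* x₁₀) :- con (ℕ→ℚ 2) :* (ι₂ :* x₀₁) :+ con (ℕ→ℚ 2) :* (ι₁ :* (ι₂ :* x₁₁))
           := ((x :+ x) :- con 1ℚ :* (ι₁ :* (x₁₀ :+ x₁₀)) :- con 1ℚ :* (ι₂ :* (x₀₁ :+ x₀₁))
                 :+ con 1ℚ :* (ι₁ :* (ι₂ :* (x₁₁ :+ x₁₁)))) :- x)
         refl (isSuc c) (isSuc d) (h c d) (h (c ∸ 1) d) (h c (d ∸ 1)) (h (c ∸ 1) (d ∸ 1)) ⟩
    Δ (λ c d → h c d + h c d) c d - h c d
      ≡⟨ cong₂ _-_ (Op-cong 1ℚ 1ℚ 1ℚ rec c d) (sym (Δ-partialSum h c d)) ⟩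
    Δ (λ c d → N c d + partialSum h c d) c d - Δ (partialSum h) c d
      ≡⟨ solve 10 (λ ι₁ ι₂ n n₁₀ n₀₁ n₁₁ s s₁₀ s₀₁ s₁₁ →
            ((n :+ s) :- con 1ℚ :* (ι₁ :* (n₁₀ :+ s₁₀)) :- con 1ℚ :* (ι₂ :* (n₀₁ :+ s₀₁))
              :+ con 1ℚ :* (ι₁ :* (ι₂ :* (n₁₁ :+ s₁₁))))
              :- (s :- con 1ℚ :* (ι₁ :* s₁₀) :- con 1ℚ :* (ι₂ :* s₀₁) :+ con 1ℚ :* (ι₁ :* (ι₂ :* s₁₁)))
            := n :- con 1ℚ :* (ι₁ :* n₁₀) :- con 1ℚ :* (ι₂ :* n₀₁) :+ con 1ℚ :* (ι₁ :* (ι₂ :* n₁₁)))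
         refl (isSuc c) (isSuc d) (N c d) (N (c ∸ 1) d) (N c (d ∸ 1)) (N (c ∸ 1) (d ∸ 1))
              (partialSum h c d) (partialSum h (c ∸ 1) d) (partialSum h c (d ∸ 1)) (partialSum h (c ∸ 1) (d ∸ 1)) ⟩
    Δ N c d ∎
    where open ≡-Reasoning

  module _ (N : Seq₂) (s t : ℚ)
           (N-geometric₁ : ∀ c d → N c d ≡ N (suc c) d * s)
           (N-geometric₂ : ∀ c d → N c d ≡ N c (suc d) * t) where

    private
      shift₁-weight : ∀ c d → isSuc c * N (c ∸ 1) d ≡ isSuc c * (N c d * s)
      shift₁-weight zero    d = 0*≡0* (N 0 d) (N 0 d * s)
      shift₁-weight (suc c) d = cong (1ℚ *_) (N-geometric₁ c d)

      shift₂-weight : ∀ c d → isSuc d * N c (d ∸ 1) ≡ isSuc d * (N c d * t)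
      shift₂-weight c zero    = 0*≡0* (N c 0) (N c 0 * t)
      shift₂-weight c (suc d) = cong (1ℚ *_) (N-geometric₂ c d)

      shift₁₂-weight : ∀ c d → isSuc c * (isSuc d * N (c ∸ 1) (d ∸ 1)) ≡ isSuc c * (isSuc d * (N c d * (s * t)))
      shift₁₂-weight zero    d       = 0*≡0* (isSuc d * N 0 (d ∸ 1)) (isSuc d * (N 0 d * (s * t)))
      shift₁₂-weight (suc c) zero    = cong (1ℚ *_) (0*≡0* (N c 0) (N (suc c) 0 * (s * t)))
      shift₁₂-weight (suc c) (suc d) = cong (λ v → 1ℚ * (1ℚ * v)) (begin
        N c d                            ≡⟨ N-geometric₁ c d ⟩
        N (suc c) d * s                  ≡⟨ cong (_* s) (N-geometric₂ (suc c) d) ⟩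
        N (suc c) (suc d) * t * s        ≡⟨ solve 3 (λ n s t → n :* t :* s := n :* (s :* t)) refl (N (suc c) (suc d)) s t ⟩
        N (suc c) (suc d) * (s * t)      ∎)
        where open ≡-Reasoning

    Op-scale : ∀ a b g h → Op a b g (λ c d → N c d * h c d) ≗₂ (λ c d → N c d * Op (a * s) (b * t) (g * (s * t)) h c d)
    Op-scale a b g h c d = begin
      Op a b g (λ c d → N c d * h c d) c d
        ≡⟨ solve 13 (λ a b g ι₁ ι₂ n x n₁₀ x₁₀ n₀₁ x₀₁ n₁₁ x₁₁ →
             n :* x :- a :* (ι₁ :* (n₁₀ :* x₁₀)) :- b :* (ι₂ :* (n₀₁ :* x₀₁)) :+ g :* (ι₁ :* (ι₂ :* (n₁₁ :* x₁₁)))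
             := n :* x :- a :* ((ι₁ :* n₁₀) :* x₁₀) :- b :* ((ι₂ :* n₀₁) :* x₀₁) :+ g :* ((ι₁ :* (ι₂ :* n₁₁)) :* x₁₁))
           refl a b g (isSuc c) (isSuc d) (N c d) (h c d) (N (c ∸ 1) d) (h (c ∸ 1) d)
                (N c (d ∸ 1)) (h c (d ∸ 1)) (N (c ∸ 1) (d ∸ 1)) (h (c ∸ 1) (d ∸ 1)) ⟩
      N c d * h c d - a * (isSuc c * N (c ∸ 1) d * h (c ∸ 1) d) - b * (isSuc d * N c (d ∸ 1) * h c (d ∸ 1))
        + g * (isSuc c * (isSuc d * N (c ∸ 1) (d ∸ 1)) * h (c ∸ 1) (d ∸ 1))
        ≡⟨ cong₂ (λ u v → N c d * h c d - a * (u * h (c ∸ 1) d) - b * (v * h c (d ∸ 1))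
                            + g * (isSuc c * (isSuc d * N (c ∸ 1) (d ∸ 1)) * h (c ∸ 1) (d ∸ 1)))
                 (shift₁-weight c d) (shift₂-weight c d) ⟩
      N c d * h c d - a * (isSuc c * (N c d * s) * h (c ∸ 1) d) - b * (isSuc d * (N c d * t) * h c (d ∸ 1))
        + g * (isSuc c * (isSuc d * N (c ∸ 1) (d ∸ 1)) * h (c ∸ 1) (d ∸ 1))
        ≡⟨ cong (λ u → N c d * h c d - a * (isSuc c * (N c d * s) * h (c ∸ 1) d) - b * (isSuc d * (N c d * t) * h c (d ∸ 1))
                         + g * (u * h (c ∸ 1) (d ∸ 1)))
                (shift₁₂-weight c d) ⟩
      N c d * h c d - a * (isSuc c * (N c d * s) * h (c ∸ 1) d) - b * (isSuc d * (N c d * t) * h c (d ∸ 1))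
        + g * (isSuc c * (isSuc d * (N c d * (s * t))) * h (c ∸ 1) (d ∸ 1))
        ≡⟨ solve 12 (λ a b g s t ι₁ ι₂ n x x₁₀ x₀₁ x₁₁ →
             n :* x :- a :* (ι₁ :* (n :* s) :* x₁₀) :- b :* (ι₂ :* (n :* t) :* x₀₁) :+ g :* (ι₁ :* (ι₂ :* (n :* (s :* t))) :* x₁₁)
             := n :* (x :- (a :* s) :* (ι₁ :* x₁₀) :- (b :* t) :* (ι₂ :* x₀₁) :+ (g :* (s :* t)) :* (ι₁ :* (ι₂ :* x₁₁))))
           refl a b g s t (isSuc c) (isSuc d) (N c d) (h c d) (h (c ∸ 1) d) (h c (d ∸ 1)) (h (c ∸ 1) (d ∸ 1)) ⟩
      N c d * Op (a * s) (b * t) (g * (s * t)) h c d ∎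
      where open ≡-Reasoning

module PrimePairFormula {p q} (p-prime : Prime p) (q-prime : Prime q) (p≢q : p ≢ q) where

  open Divisors using (b-unfold; divisorTerm; divisorTerm-self; module PrimePair)
  open Rationals
  open BinomialSums
  open DoubleSequences
  open import Data.Nat as ℕ using (ℕ; zero; suc; _^_; _∸_)
  import Data.Nat.Properties as ℕ
  open import Data.Nat.Divisibility using (_∣?_; ∣⇒≤)
  open import Data.Nat.Primality using (prime⇒nonZero)
  open import Data.Product using (_,_; proj₁; proj₂)
  open import Data.Fin using (toℕ)
  open import Data.Rational
  open import Data.Rational.Properties
  open import Data.Rational.Solver using (module +-*-Solver)
  open +-*-Solver using (solve; _:+_; _:*_; _:-_; _:=_; con)
  open import Relation.Nullary using (yes; no)
  open import Relation.Binary.PropositionalEquality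

  open PrimePair p-prime q-prime p≢q

  private instance
    p≢0 : ℕ.NonZero p
    p≢0 = prime⇒nonZero p-prime
    q≢0 : ℕ.NonZero q
    q≢0 = prime⇒nonZero q-prime

  divisorTerm-expand : ∀ c d (g : ℕ → ℕ) m →
    ℕ→ℚ (divisorTerm g (monomial c d) m) ≡ sumTo c (λ i → sumTo d (λ j → ifEq m (monomial i j) (ℕ→ℚ (g m))))
  divisorTerm-expand c d g m with m ∣? monomial c d
  ... | no m∤M = sym (sumTo-zero c (λ i i≤c → sumTo-zero d (λ j j≤d →
          ifEq-≢ m (monomial i j) (ℕ→ℚ (g m)) (λ { refl → m∤M (monomial-mono-∣ {i} {j} i≤c j≤d) }))))
  ... | yes m∣M with ∣monomial⇒ c d m∣M
  ...   | i₀ , j₀ , i₀≤c , j₀≤d , refl = sym (begin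
    sumTo c (λ i → sumTo d (λ j → ifEq (monomial i₀ j₀) (monomial i j) G))
      ≡⟨ sumTo-single c i₀ i₀≤c (λ i _ i≢i₀ → sumTo-zero d (λ j _ →
           ifEq-≢ (monomial i₀ j₀) (monomial i j) G (λ eq → i≢i₀ (sym (proj₁ (monomial-injective i₀ j₀ i j eq)))))) ⟩
    sumTo d (λ j → ifEq (monomial i₀ j₀) (monomial i₀ j) G)
      ≡⟨ sumTo-single d j₀ j₀≤d (λ j _ j≢j₀ →
           ifEq-≢ (monomial i₀ j₀) (monomial i₀ j) G (λ eq → j≢j₀ (sym (proj₂ (monomial-injective i₀ j₀ i₀ j eq))))) ⟩
    ifEq (monomial i₀ j₀) (monomial i₀ j₀) G
      ≡⟨ ifEq-≡ (monomial i₀ j₀) (monomial i₀ j₀) G refl ⟩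
    G ∎)
    where
    open ≡-Reasoning
    G = ℕ→ℚ (g (monomial i₀ j₀))

  sumTo-divisorTerm : ∀ c d (g : ℕ → ℕ) →
    sumTo (monomial c d) (λ m → ℕ→ℚ (divisorTerm g (monomial c d) m))
      ≡ sumTo c (λ i → sumTo d (λ j → ℕ→ℚ (g (monomial i j))))
  sumTo-divisorTerm c d g = begin
    sumTo M (λ m → ℕ→ℚ (divisorTerm g M m))
      ≡⟨ sumTo-cong M (λ m _ → divisorTerm-expand c d g m) ⟩
    sumTo M (λ m → sumTo c (λ i → sumTo d (λ j → ifEq m (monomial i j) (G m))))
      ≡⟨ sumTo-comm M c _ ⟩
    sumTo c (λ i → sumTo M (λ m → sumTo d (λ j → ifEq m (monomial i j) (G m))))
      ≡⟨ sumTo-cong c (λ i _ → sumTo-comm M d _) ⟩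
    sumTo c (λ i → sumTo d (λ j → sumTo M (λ m → ifEq m (monomial i j) (G m))))
      ≡⟨ sumTo-cong c (λ i i≤c → sumTo-cong d (λ j j≤d →
           sumTo-ifEq M (monomial i j) G (∣⇒≤ {{monomial≢0 c d}} (monomial-mono-∣ i≤c j≤d)))) ⟩
    sumTo c (λ i → sumTo d (λ j → G (monomial i j))) ∎
    where
    open ≡-Reasoning
    M = monomial c d
    G = λ m → ℕ→ℚ (g m)

  N F : Seq₂
  N c d = ℕ→ℚ (monomial c d)
  F c d = ℕ→ℚ (b (monomial c d))

  F-recurrence : ∀ c d → F c d + F c d ≡ N c d + partialSum F c d
  F-recurrence c d = begin
    ℕ→ℚ (b M) + ℕ→ℚ (b M)
      ≡⟨ cong (λ n → ℕ→ℚ n + ℕ→ℚ (b M)) (b-unfold M) ⟩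
    ℕ→ℚ (M ℕ.+ S) + ℕ→ℚ (b M)
      ≡⟨ cong (_+ ℕ→ℚ (b M)) (ℕ→ℚ-homo-+ M S) ⟩
    ℕ→ℚ M + ℕ→ℚ S + ℕ→ℚ (b M)
      ≡⟨ +-assoc (ℕ→ℚ M) (ℕ→ℚ S) (ℕ→ℚ (b M)) ⟩
    ℕ→ℚ M + (ℕ→ℚ S + ℕ→ℚ (b M))
      ≡⟨ cong (λ n → ℕ→ℚ M + (ℕ→ℚ S + ℕ→ℚ n)) (sym (divisorTerm-self b M)) ⟩
    ℕ→ℚ M + (ℕ→ℚ S + ℕ→ℚ (divisorTerm b M M))
      ≡⟨ cong (ℕ→ℚ M +_) (trans (ℕ→ℚ-sumFin M (divisorTerm b M)) (sumTo-divisorTerm c d b)) ⟩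
    N c d + partialSum F c d ∎
    where
    open ≡-Reasoning
    M = monomial c d
    S = sumFin M (λ i → divisorTerm b M (toℕ i))

  s t : ℚ
  s = 1ℚ /ℕ p
  t = 1ℚ /ℕ q

  N-geometric₁ : ∀ c d → N c d ≡ N (suc c) d * s
  N-geometric₁ c d = sym (begin
    ℕ→ℚ (monomial (suc c) d) * s   ≡⟨ cong (λ n → ℕ→ℚ n * s) (monomial-suc₁ c d) ⟩
    ℕ→ℚ (p ℕ.* monomial c d) * s   ≡⟨ cong (_* s) (ℕ→ℚ-homo-* p (monomial c d)) ⟩
    ℕ→ℚ p * N c d * s              ≡⟨ *-cancel-1/ℕ (N c d) p ⟩
    N c d                          ∎)
    where open ≡-Reasoning

  N-geometric₂ : ∀ c d → N c d ≡ N c (suc d) * t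
  N-geometric₂ c d = sym (begin
    ℕ→ℚ (monomial c (suc d)) * t   ≡⟨ cong (λ n → ℕ→ℚ n * t) (monomial-suc₂ c d) ⟩
    ℕ→ℚ (q ℕ.* monomial c d) * t   ≡⟨ cong (_* t) (ℕ→ℚ-homo-* q (monomial c d)) ⟩
    ℕ→ℚ q * N c d * t              ≡⟨ *-cancel-1/ℕ (N c d) q ⟩
    N c d                          ∎)
    where open ≡-Reasoning

  two : ℚ
  two = ℕ→ℚ 2

  α β : ℕ → ℚ
  α i = ℕ→ℚ (2 ^ i) /ℕ (p ^ i)
  β j = 1ℚ /ℕ (q ^ j)

  α-suc : ∀ i → α (suc i) ≡ (two * s) * α i
  α-suc i = ^/ℕ^-suc 2 p i

  β-suc : ∀ j → β (suc j) ≡ t * β j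
  β-suc j = /ℕ-distrib-* 1ℚ 1ℚ q (q ^ j) {{q≢0}} {{ℕ.m^n≢0 q j}}

  u : Seq₂
  u i j = α i * (β j * binomialSum i j)

  -- Off the axes this is binomialSum-suc-suc; on them binomialSum i 0 = 1 and binomialSum-zero-suc.
  u-impulse : Op (two * s) (two * t) (two * (s * t)) u ≗₂ corner
  u-impulse zero    zero    =
    solve 3 (λ x y z → con 1ℚ :- x :* (con 0ℚ :* con 1ℚ) :- y :* (con 0ℚ :* con 1ℚ) :+ z :* (con 0ℚ :* (con 0ℚ :* con 1ℚ))
                       := con 1ℚ)
      refl (two * s) (two * t) (two * (s * t))
  u-impulse (suc c) zero    = trans
    (cong (λ a → a * (1ℚ * 1ℚ) - two * s * (1ℚ * u c 0) - two * t * (0ℚ * (a * (1ℚ * 1ℚ))) + two * (s * t) * (1ℚ * (0ℚ * u c 0)))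
          (α-suc c))
    (solve 4 (λ s t a u → (con two :* s :* a) :* (con 1ℚ :* con 1ℚ) :- con two :* s :* (con 1ℚ :* (a :* (con 1ℚ :* con 1ℚ)))
                            :- con two :* t :* (con 0ℚ :* ((con two :* s :* a) :* (con 1ℚ :* con 1ℚ)))
                            :+ con two :* (s :* t) :* (con 1ℚ :* (con 0ℚ :* u)) := con 0ℚ)
      refl s t (α c) (u c 0))
  u-impulse zero    (suc d) = trans
    (cong₂ (λ b A → 1ℚ * (b * A) - two * s * (0ℚ * (1ℚ * (b * A))) - two * t * (1ℚ * u 0 d) + two * (s * t) * (0ℚ * (1ℚ * u 0 d)))
           (β-suc d) (binomialSum-zero-suc d))
    (solve 4 (λ s t b A → con 1ℚ :* ((t :* b) :* (con two :* A)) :- con two :* s :* (con 0ℚ :* (con 1ℚ :* ((t :* b) :* (con two :* A))))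
                            :- con two :* t :* (con 1ℚ :* (con 1ℚ :* (b :* A)))
                            :+ con two :* (s :* t) :* (con 0ℚ :* (con 1ℚ :* (con 1ℚ :* (b :* A)))) := con 0ℚ)
      refl s t (β d) (binomialSum 0 d))
  u-impulse (suc c) (suc d) = trans
    (cong₂ (λ a b → a * (b * A (suc c) (suc d)) - two * s * (1ℚ * (α c * (b * A c (suc d))))
                      - two * t * (1ℚ * (a * (β d * A (suc c) d))) + two * (s * t) * (1ℚ * (1ℚ * u c d)))
           (α-suc c) (β-suc d))
    (trans (cong (λ v → (two * s * α c) * ((t * β d) * v) - two * s * (1ℚ * (α c * ((t * β d) * A c (suc d))))
                         - two * t * (1ℚ * ((two * s * α c) * (β d * A (suc c) d))) + two * (s * t) * (1ℚ * (1ℚ * u c d)))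
                (binomialSum-suc-suc c d))
    (solve 7 (λ s t a b A₀₁ A₁₀ A₀₀ →
        (con two :* s :* a) :* ((t :* b) :* (A₀₁ :+ con two :* A₁₀ :- A₀₀))
        :- con two :* s :* (con 1ℚ :* (a :* ((t :* b) :* A₀₁)))
        :- con two :* t :* (con 1ℚ :* ((con two :* s :* a) :* (b :* A₁₀)))
        :+ con two :* (s :* t) :* (con 1ℚ :* (con 1ℚ :* (a :* (b :* A₀₀))))
        := con 0ℚ)
      refl s t (α c) (β d) (A c (suc d)) (A (suc c) d) (A c d)))
    where
    A = binomialSum

  P E : Seq₂
  P = partialSum u
  E c d = ½ + ½ * P c d

  -- By Op-scale it suffices that Op (2s) (2t) (2st) E = Op s t (st) one, and E is affine in P,
  -- whose image under Op (2s) (2t) (2st) is one.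
  NE-recurrence : Op two two two (λ c d → N c d * E c d) ≗₂ Δ N
  NE-recurrence c d = begin
    Op two two two (λ c d → N c d * E c d) c d
      ≡⟨ Op-scale N s t N-geometric₁ N-geometric₂ two two two E c d ⟩
    N c d * Op (two * s) (two * t) (two * (s * t)) E c d
      ≡⟨ cong (N c d *_) (solve 8 (λ s t ι₁ ι₂ x x₁₀ x₀₁ x₁₁ →
           (con ½ :+ con ½ :* x) :- con two :* s :* (ι₁ :* (con ½ :+ con ½ :* x₁₀))
             :- con two :* t :* (ι₂ :* (con ½ :+ con ½ :* x₀₁)) :+ con two :* (s :* t) :* (ι₁ :* (ι₂ :* (con ½ :+ con ½ :* x₁₁)))
           := (con 1ℚ :- con 1ℚ :* s :* (ι₁ :* con 1ℚ) :- con 1ℚ :* t :* (ι₂ :* con 1ℚ)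
                :+ con 1ℚ :* (s :* t) :* (ι₁ :* (ι₂ :* con 1ℚ))) :- con ½
             :+ con ½ :* (x :- con two :* s :* (ι₁ :* x₁₀) :- con two :* t :* (ι₂ :* x₀₁)
                          :+ con two :* (s :* t) :* (ι₁ :* (ι₂ :* x₁₁))))
         refl s t (isSuc c) (isSuc d) (P c d) (P (c ∸ 1) d) (P c (d ∸ 1)) (P (c ∸ 1) (d ∸ 1))) ⟩
    N c d * (Op (1ℚ * s) (1ℚ * t) (1ℚ * (s * t)) one c d - ½ + ½ * Op (two * s) (two * t) (two * (s * t)) P c d)
      ≡⟨ cong (λ v → N c d * (Op (1ℚ * s) (1ℚ * t) (1ℚ * (s * t)) one c d - ½ + ½ * v))
              (partialSum-of-impulse (two * s) (two * t) (two * (s * t)) u u-impulse c d) ⟩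
    N c d * (Op (1ℚ * s) (1ℚ * t) (1ℚ * (s * t)) one c d - ½ + ½ * 1ℚ)
      ≡⟨ cong (N c d *_) (solve 1 (λ o → o :- con ½ :+ con ½ :* con 1ℚ := o) refl (Op (1ℚ * s) (1ℚ * t) (1ℚ * (s * t)) one c d)) ⟩
    N c d * Op (1ℚ * s) (1ℚ * t) (1ℚ * (s * t)) one c d
      ≡⟨ sym (Op-scale N s t N-geometric₁ N-geometric₂ 1ℚ 1ℚ 1ℚ one c d) ⟩
    Δ (λ c d → N c d * 1ℚ) c d
      ≡⟨ Op-cong 1ℚ 1ℚ 1ℚ (λ c d → *-identityʳ (N c d)) c d ⟩
    Δ N c d ∎
    where open ≡-Reasoning

  F≗NE : F ≗₂ λ c d → N c d * E c d
  F≗NE = Op-injective two two two (λ c d → trans (recurrence⇒Op N F F-recurrence c d) (sym (NE-recurrence c d)))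

  B-monomial : ∀ c d → B (monomial c d) ≡ ½ + ½ * sumTo c (λ i → α i * sumTo d (λ j → β j * binomialSum i j))
  B-monomial c d = begin
    F c d /ℕ monomial c d                  ≡⟨ /ℕ≡*1/ℕ (F c d) (monomial c d) ⟩
    F c d * (1ℚ /ℕ monomial c d)           ≡⟨ cong (_* (1ℚ /ℕ monomial c d)) (F≗NE c d) ⟩
    N c d * E c d * (1ℚ /ℕ monomial c d)   ≡⟨ *-cancel-1/ℕ (E c d) (monomial c d) {{monomial≢0 c d}} ⟩
    E c d                                  ≡⟨ cong (λ v → ½ + ½ * v) (sumTo-cong c (λ i _ → sym (*-distribˡ-sumTo d (α i) _))) ⟩
    ½ + ½ * sumTo c (λ i → α i * sumTo d (λ j → β j * binomialSum i j)) ∎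
    where open ≡-Reasoning

module Corollaries where

  open Rationals
  open BinomialSums
  open import Data.Nat as ℕ using (ℕ; zero; suc; _^_; _∸_)
  import Data.Nat.Properties as ℕ
  open import Data.Nat.Divisibility using (_∣_; divides)
  open import Data.Nat.Primality using (Prime; prime[2]; prime?)
  open import Data.Nat.Combinatorics using (_C_)
  open import Data.Empty using (⊥-elim)
  open import Data.Rational
  open import Data.Rational.Properties
  open import Data.Rational.Solver using (module +-*-Solver)
  open +-*-Solver using (solve; _:+_; _:*_; _:-_; _:=_; con)
  open import Relation.Nullary using (¬_)
  open import Relation.Nullary.Decidable using (toWitness)
  open import Relation.Binary.PropositionalEquality

  B-prime-pair : ∀ p q c d → Prime p → Prime q → p ≢ q →
    B (p ^ c ℕ.* q ^ d)
      ≡ ½ + ½ * sumTo c (λ i → (ℕ→ℚ (2 ^ i) /ℕ (p ^ i)) * sumTo d (λ j → (1ℚ /ℕ (q ^ j)) * binomialSum i j))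
  B-prime-pair p q c d p-prime q-prime p≢q = PrimePairFormula.B-monomial p-prime q-prime p≢q c d

  geometric-closed-form : ∀ m c → let p = suc (suc m) in
    (½ + ½ * sumTo c (λ i → ℕ→ℚ (2 ^ i) /ℕ (p ^ i))) * ℕ→ℚ m ≡ ℕ→ℚ (suc m) - ℕ→ℚ (2 ^ c) /ℕ (p ^ c)
  geometric-closed-form m zero = begin
    (½ + ½ * 1ℚ) * ℕ→ℚ m   ≡⟨ solve 1 (λ x → (con ½ :+ con ½ :* con 1ℚ) :* x := (x :+ con 1ℚ) :- con 1ℚ) refl (ℕ→ℚ m) ⟩
    (ℕ→ℚ m + 1ℚ) - 1ℚ      ≡⟨ cong (_- 1ℚ) (sym (trans (cong ℕ→ℚ (ℕ.+-comm 1 m)) (ℕ→ℚ-homo-+ m 1))) ⟩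
    ℕ→ℚ (suc m) - 1ℚ       ∎
    where open ≡-Reasoning
  geometric-closed-form m (suc c) = begin
    (½ + ½ * (S + α (suc c))) * M
      ≡⟨ cong (λ v → (½ + ½ * (S + v)) * M) (^/ℕ^-suc 2 p c) ⟩
    (½ + ½ * (S + two * s * α c)) * M
      ≡⟨ solve 4 (λ S s a M → (con ½ :+ con ½ :* (S :+ con two :* s :* a)) :* M
                              := (con ½ :+ con ½ :* S) :* M :+ a :* (s :* (M :+ con two)) :- con two :* s :* a)
           refl S s (α c) M ⟩
    (½ + ½ * S) * M + α c * (s * (M + two)) - two * s * α c
      ≡⟨ cong₂ (λ u v → u + α c * v - two * s * α c) (geometric-closed-form m c) s*p≡1 ⟩
    (ℕ→ℚ (suc m) - α c) + α c * 1ℚ - two * s * α c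
      ≡⟨ solve 3 (λ M₁ a x → (M₁ :- a) :+ a :* con 1ℚ :- x := M₁ :- x) refl (ℕ→ℚ (suc m)) (α c) (two * s * α c) ⟩
    ℕ→ℚ (suc m) - two * s * α c
      ≡⟨ cong (λ v → ℕ→ℚ (suc m) - v) (sym (^/ℕ^-suc 2 p c)) ⟩
    ℕ→ℚ (suc m) - α (suc c) ∎
    where
    open ≡-Reasoning
    p = suc (suc m)
    two = ℕ→ℚ 2
    M = ℕ→ℚ m
    s = 1ℚ /ℕ p
    α : ℕ → ℚ
    α i = ℕ→ℚ (2 ^ i) /ℕ (p ^ i)
    S = sumTo c α
    s*p≡1 : s * (M + two) ≡ 1ℚ
    s*p≡1 = trans (cong (s *_) (sym (trans (cong ℕ→ℚ (ℕ.+-comm 2 m)) (ℕ→ℚ-homo-+ m 2)))) (1/ℕ-inverseˡ p)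

  B-odd-prime^ : ∀ p c → Prime p → ¬ (2 ∣ p) → B (p ^ c) ≡ (ℕ→ℚ (p ∸ 1) - ℕ→ℚ (2 ^ c) /ℕ (p ^ c)) /ℕ (p ∸ 2)
  B-odd-prime^ 0 c () _
  B-odd-prime^ 1 c () _
  B-odd-prime^ 2 c _ 2∤2 = ⊥-elim (2∤2 (divides 1 refl))
  B-odd-prime^ p@(suc (suc (suc r))) c p-prime _ = begin
    B (p ^ c)
      ≡⟨ cong B (sym (ℕ.*-identityʳ (p ^ c))) ⟩
    B (p ^ c ℕ.* 2 ^ 0)
      ≡⟨ B-prime-pair p 2 c 0 p-prime prime[2] (λ ()) ⟩
    ½ + ½ * sumTo c (λ i → α i * 1ℚ)
      ≡⟨ cong (λ v → ½ + ½ * v) (sumTo-cong c (λ i _ → *-identityʳ (α i))) ⟩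
    E
      ≡⟨ sym (*-cancel-1/ℕ E (suc r)) ⟩
    (ℕ→ℚ (suc r) * E) * (1ℚ /ℕ suc r)
      ≡⟨ cong (_* (1ℚ /ℕ suc r)) (trans (*-comm (ℕ→ℚ (suc r)) E) (geometric-closed-form (suc r) c)) ⟩
    (ℕ→ℚ (suc (suc r)) - α c) * (1ℚ /ℕ suc r)
      ≡⟨ sym (/ℕ≡*1/ℕ (ℕ→ℚ (suc (suc r)) - α c) (suc r)) ⟩
    (ℕ→ℚ (suc (suc r)) - α c) /ℕ suc r ∎
    where
    open ≡-Reasoning
    α : ℕ → ℚ
    α i = ℕ→ℚ (2 ^ i) /ℕ (p ^ i)
    E = ½ + ½ * sumTo c α

  B-2^c : ∀ c → B (2 ^ c) ≡ ℕ→ℚ (c ℕ.+ 2) /ℕ 2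
  B-2^c c = begin
    B (2 ^ c)
      ≡⟨ cong B (sym (ℕ.*-identityʳ (2 ^ c))) ⟩
    B (2 ^ c ℕ.* 3 ^ 0)
      ≡⟨ B-prime-pair 2 3 c 0 prime[2] prime[3] (λ ()) ⟩
    ½ + ½ * sumTo c (λ i → (ℕ→ℚ (2 ^ i) /ℕ (2 ^ i)) * 1ℚ)
      ≡⟨ cong (λ v → ½ + ½ * v) (trans (sumTo-cong c (λ i _ → trans (*-identityʳ _) (n/ℕn≡1 (2 ^ i) {{ℕ.m^n≢0 2 i}}))) (sumTo-1 c)) ⟩
    ½ + ½ * ℕ→ℚ (suc c)
      ≡⟨ cong (λ v → ½ + ½ * v) (trans (cong ℕ→ℚ (ℕ.+-comm 1 c)) (ℕ→ℚ-homo-+ c 1)) ⟩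
    ½ + ½ * (ℕ→ℚ c + 1ℚ)
      ≡⟨ solve 1 (λ x → con ½ :+ con ½ :* (x :+ con 1ℚ) := (x :+ con (ℕ→ℚ 2)) :* con ½) refl (ℕ→ℚ c) ⟩
    (ℕ→ℚ c + ℕ→ℚ 2) * ½
      ≡⟨ cong (_* ½) (sym (ℕ→ℚ-homo-+ c 2)) ⟩
    ℕ→ℚ (c ℕ.+ 2) /ℕ 2 ∎
    where
    open ≡-Reasoning
    prime[3] : Prime 3
    prime[3] = toWitness {a? = prime? 3} _

  B-2^c*q^d : ∀ q c d → Prime q → q ≢ 2 →
    B (2 ^ c ℕ.* q ^ d)
      ≡ ½ + ½ * sumTo d (λ j → (1ℚ /ℕ (q ^ j)) * sumTo j (λ k → ℕ→ℚ ((j C k) ℕ.* ((c ℕ.+ k ℕ.+ 1) C (k ℕ.+ 1)))))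
  B-2^c*q^d q c d q-prime q≢2 =
    trans (B-prime-pair 2 q c d prime[2] q-prime (λ 2≡q → q≢2 (sym 2≡q))) (cong (λ v → ½ + ½ * v) (begin
      sumTo c (λ i → (ℕ→ℚ (2 ^ i) /ℕ (2 ^ i)) * sumTo d (λ j → β j * binomialSum i j))
        ≡⟨ sumTo-cong c (λ i _ → trans (cong (_* sumTo d (λ j → β j * binomialSum i j)) (n/ℕn≡1 (2 ^ i) {{ℕ.m^n≢0 2 i}}))
                                       (*-identityˡ _)) ⟩
      sumTo c (λ i → sumTo d (λ j → β j * binomialSum i j))
        ≡⟨ sumTo-comm c d (λ i j → β j * binomialSum i j) ⟩
      sumTo d (λ j → sumTo c (λ i → β j * binomialSum i j))
        ≡⟨ sumTo-cong d (λ j _ → sym (*-distribˡ-sumTo c (β j) (λ i → binomialSum i j))) ⟩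
      sumTo d (λ j → β j * sumTo c (λ i → binomialSum i j))
        ≡⟨ sumTo-cong d (λ j _ → cong (β j *_) (trans (sumTo-comm c j _) (sumTo-cong j (λ k _ → column j k)))) ⟩
      sumTo d (λ j → β j * sumTo j (λ k → ℕ→ℚ ((j C k) ℕ.* ((c ℕ.+ k ℕ.+ 1) C (k ℕ.+ 1))))) ∎))
    where
    open ≡-Reasoning
    β : ℕ → ℚ
    β j = 1ℚ /ℕ (q ^ j)
    column : ∀ j k → sumTo c (λ i → ℕ→ℚ (((i ℕ.+ k) C k) ℕ.* (j C k))) ≡ ℕ→ℚ ((j C k) ℕ.* ((c ℕ.+ k ℕ.+ 1) C (k ℕ.+ 1)))
    column j k = begin
      sumTo c (λ i → ℕ→ℚ (((i ℕ.+ k) C k) ℕ.* (j C k)))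
        ≡⟨ sumTo-cong c (λ i _ → trans (cong ℕ→ℚ (ℕ.*-comm ((i ℕ.+ k) C k) (j C k))) (ℕ→ℚ-homo-* (j C k) _)) ⟩
      sumTo c (λ i → ℕ→ℚ (j C k) * ℕ→ℚ ((i ℕ.+ k) C k))
        ≡⟨ sym (*-distribˡ-sumTo c (ℕ→ℚ (j C k)) _) ⟩
      ℕ→ℚ (j C k) * sumTo c (λ i → ℕ→ℚ ((i ℕ.+ k) C k))
        ≡⟨ cong (ℕ→ℚ (j C k) *_) (hockey-stick c k) ⟩
      ℕ→ℚ (j C k) * ℕ→ℚ ((c ℕ.+ k ℕ.+ 1) C (k ℕ.+ 1))
        ≡⟨ sym (ℕ→ℚ-homo-* (j C k) _) ⟩
      ℕ→ℚ ((j C k) ℕ.* ((c ℕ.+ k ℕ.+ 1) C (k ℕ.+ 1))) ∎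

open import Data.Nat using (ℕ; _+_; _*_; _∸_; _^_)
open import Data.Nat.Primality using (Prime)
open import Data.Nat.Divisibility using (_∣_)
open import Data.Nat.Combinatorics using (_C_)
open import Data.Rational using (½; 1ℚ) renaming (_+_ to _+ℚ_; _-_ to _-ℚ_; _*_ to _*ℚ_)
open import Data.Product using (_×_; _,_)
open import Relation.Nullary using (¬_)
open import Relation.Binary.PropositionalEquality using (_≡_; _≢_)
open Corollaries using (B-odd-prime^; B-2^c; B-prime-pair; B-2^c*q^d)

theorem7 :
    (∀ (p c : ℕ) → Prime p → ¬ (2 ∣ p) →
       B (p ^ c) ≡ (ℕ→ℚ (p ∸ 1) -ℚ (ℕ→ℚ (2 ^ c) /ℕ (p ^ c))) /ℕ (p ∸ 2))
    × (∀ (c : ℕ) → B (2 ^ c) ≡ ℕ→ℚ (c + 2) /ℕ 2)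
    × (∀ (p q c d : ℕ) → Prime p → Prime q → p ≢ q →
       B (p ^ c * q ^ d)
         ≡ ½ +ℚ ½ *ℚ sumTo c (λ i → (ℕ→ℚ (2 ^ i) /ℕ (p ^ i)) *ℚ
             sumTo d (λ j → (1ℚ /ℕ (q ^ j)) *ℚ
               sumTo j (λ k → ℕ→ℚ (((i + k) C k) * (j C k))))))
    × (∀ (q c d : ℕ) → Prime q → q ≢ 2 →
       B (2 ^ c * q ^ d)
         ≡ ½ +ℚ ½ *ℚ sumTo d (λ j → (1ℚ /ℕ (q ^ j)) *ℚ
             sumTo j (λ k → ℕ→ℚ ((j C k) * ((c + k + 1) C (k + 1))))))
theorem7 = B-odd-prime^ , B-2^c , B-prime-pair , B-2^c*q^d
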